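{- Let $n\ge 4$ and let $S\subseteq V(FQ_n)$ be such that the characteristic matrix $X(S)$ has a zero row and distinct, nonzero columns. Suppose $\phi\in S_{n+1}$ satisfies $\phi(\mathbf{e}_i)=\mathbf{1}$ for some $i\in[n]$. If $\phi$ fixes every vertex in $S$, then $\phi$, as a permutation of $\{\mathbf{e}_1,\dots,\mathbf{e}_n,\mathbf{1}\}$, is a product of transpositions that leaves no $\mathbf{e}_j$ fixed, $n$ is odd, and the sum (over $\mathbb{Z}_2$) of the columns of $X(S)$ is $\sum_{s=1}^n \mathrm{col}_s X(S)=\mathrm{col}_i X(S)$ if $n\equiv 1\pmod 4$, and $=\mathbf{0}$ if $n\equiv 3\pmod 4$.
   Context: $FQ_n$ is the folded hypercube: vertex set $\mathbb{Z}_2^n$, two vertices adjacent iff they differ in exactly one position or in all $n$ positions. $\mathbf{e}_j$ is the string with $1$ in position $j$ and $0$ elsewhere, $\mathbf{1}$ the all-ones string. Elements $\phi$ of $S_{n+1}$ are regarded as permutations of the set $\{\mathbf{e}_1,\dots,\mathbf{e}_n,\mathbf{1}\}$, acting on $\mathbb{Z}_2^n$ by linear extension: $\phi(a_1\dots a_n)=a_1\phi(\mathbf{e}_1)+\dots+a_n\phi(\mathbf{e}_n)$ (these are automorphisms of $FQ_n$); $\phi$ fixes $\mathbf{a}$ if $\phi(\mathbf{a})=\mathbf{a}$. For an ordered set $S=\{\mathbf{v}_1,\dots,\mathbf{v}_r\}$, the characteristic matrix $X(S)$ is the $r\times n$ binary matrix whose $(t,j)$ entry is the $j$-th position of $\mathbf{v}_t$;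 $\mathrm{col}_s X(S)$ is its $s$-th column. -}

module Defs where

open import Data.Nat using (ℕ; zero; suc; _≡ᵇ_; _%_)
open import Data.Bool using (Bool; true; false; _xor_; _∧_; _∨_)
open import Data.Fin using (Fin; zero; suc; inject₁; fromℕ; toℕ)
open import Data.Fin.Permutation using (Permutation′; _⟨$⟩ʳ_)
open import Relation.Binary.PropositionalEquality using (_≡_; _≢_)
open import Data.Product using (∃; _×_)
open import Relation.Nullary using (¬_)

-- Vertices of FQ_n: binary strings of length n, as functions Fin n → Bool
-- (true = 1, false = 0; addition in Z_2 is xor).
Vertex : ℕ → Set
Vertex n = Fin n → Bool

xorSum : ∀ {m} → (Fin m → Bool) → Bool
xorSum {zero}  f = false
xorSum {suc m} f = f zero xor xorSum (λ k → f (suc k))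

-- The n+1 symbols {e_1,...,e_n, 1} are encoded as Fin (suc n):
-- e j = inject₁ j stands for e_j  (j : Fin n),  one = fromℕ n stands for 1.
e : ∀ {n} → Fin n → Fin (suc n)
e j = inject₁ j

one : ∀ {n} → Fin (suc n)
one {n} = fromℕ n

-- the binary string denoted by a symbol: position j of e_k is [k = j],
-- every position of 1 is 1.
decode : ∀ {n} → Fin (suc n) → Vertex n
decode {n} k j = (toℕ k ≡ᵇ n) ∨ (toℕ k ≡ᵇ toℕ j)

Perm : ℕ → Set
Perm n = Permutation′ (suc n)

-- action on Z_2^n by linear extension:
-- φ(a) = a_1 φ(e_1) + ... + a_n φ(e_n), position j of the result.
act : ∀ {n} → Perm n → Vertex n → Vertex n
act φ a j = xorSum (λ s → a s ∧ decode (φ ⟨$⟩ʳ e s) j)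

Fixes : ∀ {n} → Perm n → Vertex n → Set
Fixes φ a = ∀ j → act φ a j ≡ a j

-- An ordered set S = {v_1,...,v_r} of vertices (listed without repetition).
-- Characteristic matrix X(S): entry (t, s) is position s of v_t.
X : ∀ {r n} → (Fin r → Vertex n) → Fin r → Fin n → Bool
X v t s = v t s

col : ∀ {r n} → (Fin r → Vertex n) → Fin n → Fin r → Bool
col v s t = X v t s

HasZeroRow : ∀ {r n} → (Fin r → Vertex n) → Set
HasZeroRow v = ∃ λ t → ∀ s → X v t s ≡ false

NonzeroCols : ∀ {r n} → (Fin r → Vertex n) → Set
NonzeroCols v = ∀ s → ∃ λ t → col v s t ≡ true

DistinctCols : ∀ {r n} → (Fin r → Vertex n) → Set
DistinctCols v = ∀ s s′ → s ≢ s′ → ¬ (∀ t → col v s t ≡ col v s′ t)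

DistinctRows : ∀ {r n} → (Fin r → Vertex n) → Set
DistinctRows v = ∀ t t′ → t ≢ t′ → ¬ (∀ s → v t s ≡ v t′ s)

-- φ is a product of disjoint transpositions (an involution) fixing no e_j
InvolutionNoFixedE : ∀ {n} → Perm n → Set
InvolutionNoFixedE {n} φ =
  (∀ k → φ ⟨$⟩ʳ (φ ⟨$⟩ʳ k) ≡ k) × (∀ (j : Fin n) → φ ⟨$⟩ʳ e j ≢ e j)

colSum : ∀ {r n} → (Fin r → Vertex n) → Fin r → Bool
colSum v t = xorSum (λ s → col v s t)

-- Regard a vertex a as the function â on the n + 1 symbols with â(eₖ) = aₖ and
-- â(1) = 0. Because φ(eᵢ) = 1, coordinate j of φ(a) is aᵢ + â(φ⁻¹ eⱼ), so φ fixes a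
-- exactly when â ∘ φ = aᵢ + â. Applying this twice, φ² fixes every column of X(S)
-- extended by a zero column; these columns are distinct, so φ is an involution.
-- Column i is nonzero, so some row g has gᵢ = 1, whence ĝ ∘ φ = not ∘ ĝ: φ has no
-- fixed point, and ĝ takes the value 1 on exactly half of the n + 1 symbols, say on N
-- of them. Hence n = 2N - 1 is odd, and every row a has coordinate sum aᵢ · N (mod 2):
-- if aᵢ = 1 then â also takes the value 1 exactly N times, and if aᵢ = 0 the same
-- holds for â + ĝ. Finally N is odd iff n ≡ 1 (mod 4).
module Submission where

open import Defs
open import Data.Nat using (ℕ; suc; _≤_; _%_)
open import Data.Bool using (Bool; false)
open import Data.Fin using (Fin)
open import Data.Fin.Permutation using (_⟨$⟩ʳ_)
open import Data.Product using (_×_)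
open import Relation.Binary.PropositionalEquality using (_≡_)

open import Algebra.Bundles using (CommutativeRing)
import Algebra.Properties.CommutativeMonoid.Sum as MonoidSum
open import Algebra.Properties.CommutativeSemigroup using (interchange)
open import Data.Bool using (true; _xor_; _∧_; _∨_; not; if_then_else_)
open import Data.Bool.Properties
  using (T-≡; xor-∧-commutativeRing; xor-assoc; xor-same; xor-identityʳ; not-involutive;
         not-distribˡ-xor; not-¬; ∧-distribˡ-xor; ∧-zeroʳ; ∧-identityʳ)
open import Data.Empty using (⊥; ⊥-elim)
open import Data.Fin using (zero; suc; toℕ; _≟_)
open import Data.Fin.Permutation using (Permutation′; _⟨$⟩ˡ_; inverseˡ; inverseʳ)
open import Data.Fin.Properties using (toℕ-injective; toℕ-fromℕ; toℕ-inject₁; fromℕ≢inject₁)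
open import Data.Nat using (zero; _+_; _≡ᵇ_; ⌊_/2⌋)
open import Data.Nat.DivMod using ([m+n]%n≡m%n; m∣n⇒o%n%m≡o%m)
open import Data.Nat.Divisibility using (divides)
open import Data.Nat.Properties
  using (+-0-commutativeMonoid; +-suc; suc-injective; ≡ᵇ⇒≡; ≡⇒≡ᵇ; n≡⌊n+n/2⌋)
open import Data.Nat.Tactic.RingSolver using (solve-∀)
open import Data.Product using (_,_; proj₁; proj₂)
open import Function using (_∘_; Equivalence)
open import Relation.Binary.PropositionalEquality
  using (_≢_; refl; sym; trans; cong; cong₂; subst; module ≡-Reasoning)
open import Relation.Nullary using (¬_; yes; no; contradiction)

open ≡-Reasoning
open MonoidSum +-0-commutativeMonoid using (sum; sum-permute; sum-cong-≗)

xor-cancelˡ : ∀ x y → x xor (x xor y) ≡ y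
xor-cancelˡ x y = trans (sym (xor-assoc x x y)) (cong (_xor y) (xor-same x))

xor-solveˡ : ∀ {x y b} → x ≡ b xor y → y ≡ b xor x
xor-solveˡ {y = y} {b} refl = sym (xor-cancelˡ b y)

∨-disjoint≡xor : ∀ x y → (x ≡ true → y ≡ true → ⊥) → x ∨ y ≡ x xor y
∨-disjoint≡xor false y _ = refl
∨-disjoint≡xor true false _ = refl
∨-disjoint≡xor true true disjoint = ⊥-elim (disjoint refl refl)

xor-interchange : ∀ a b c d → (a xor b) xor (c xor d) ≡ (a xor c) xor (b xor d)
xor-interchange =
  interchange (CommutativeRing.+-commutativeSemigroup xor-∧-commutativeRing)

xorSum-cong : ∀ {m} {f g : Fin m → Bool} → (∀ c → f c ≡ g c) → xorSum f ≡ xorSum g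
xorSum-cong {zero} f≗g = refl
xorSum-cong {suc m} f≗g = cong₂ _xor_ (f≗g zero) (xorSum-cong (f≗g ∘ suc))

xorSum-false : ∀ {m} → xorSum {m} (λ _ → false) ≡ false
xorSum-false {zero} = refl
xorSum-false {suc m} = xorSum-false {m}

xorSum-xor : ∀ {m} (f g : Fin m → Bool) →
  xorSum (λ c → f c xor g c) ≡ xorSum f xor xorSum g
xorSum-xor {zero} f g = refl
xorSum-xor {suc m} f g =
  trans (cong ((f zero xor g zero) xor_) (xorSum-xor (f ∘ suc) (g ∘ suc)))
        (xor-interchange (f zero) (g zero) _ _)

count : ∀ {m} → (Fin m → Bool) → ℕ
count f = sum (λ c → if f c then 1 else 0)

odd : ℕ → Bool
odd zero = false
odd (suc k) = not (odd k)

xorSum≡odd-count : ∀ {m} (f : Fin m → Bool) → xorSum f ≡ odd (count f)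
xorSum≡odd-count {zero} f = refl
xorSum≡odd-count {suc m} f with f zero
... | true = cong not (xorSum≡odd-count (f ∘ suc))
... | false = xorSum≡odd-count (f ∘ suc)

count-complement : ∀ {m} (f : Fin m → Bool) → count f + count (not ∘ f) ≡ m
count-complement {zero} f = refl
count-complement {suc m} f with f zero
... | true = cong suc (count-complement (f ∘ suc))
... | false = trans (+-suc (count (f ∘ suc)) _) (cong suc (count-complement (f ∘ suc)))

double-injective : ∀ {M N} → M + M ≡ N + N → M ≡ N
double-injective {M} {N} eq = trans (n≡⌊n+n/2⌋ M) (trans (cong ⌊_/2⌋ eq) (sym (n≡⌊n+n/2⌋ N)))

Shifts : ∀ {m} → Permutation′ m → Bool → (Fin m → Bool) → Set
Shifts π b f = ∀ c → f (π ⟨$⟩ʳ c) ≡ b xor f c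

module _ {m} (π : Permutation′ m) where

  Shifts-inverse : ∀ {b f} → (∀ c → f (π ⟨$⟩ˡ c) ≡ b xor f c) → Shifts π b f
  Shifts-inverse {b} {f} shift c =
    xor-solveˡ {b = b} (trans (cong f (sym (inverseˡ π))) (shift (π ⟨$⟩ʳ c)))

  Shifts-involutive : ∀ {b f} → Shifts π b f → ∀ c → f (π ⟨$⟩ʳ (π ⟨$⟩ʳ c)) ≡ f c
  Shifts-involutive {b} {f} shift c =
    trans (shift (π ⟨$⟩ʳ c)) (trans (cong (b xor_) (shift c)) (xor-cancelˡ b (f c)))

  Shifts-true⇒fixpoint-free : ∀ {f} → Shifts π true f → ∀ c → π ⟨$⟩ʳ c ≢ c
  Shifts-true⇒fixpoint-free {f} f-flips c πc≡c =
    not-¬ refl (trans (cong f (sym πc≡c)) (f-flips c))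

  count-permute : (f : Fin m → Bool) → count f ≡ count (f ∘ (π ⟨$⟩ʳ_))
  count-permute f = sum-permute (λ c → if f c then 1 else 0) π

  count-half : ∀ {g} → Shifts π true g → count g + count g ≡ m
  count-half {g} g-flips = begin
    count g + count g
      ≡⟨ cong (count g +_) (count-permute g) ⟩
    count g + count (g ∘ (π ⟨$⟩ʳ_))
      ≡⟨ cong (count g +_) (sum-cong-≗ (cong (λ b → if b then 1 else 0) ∘ g-flips)) ⟩
    count g + count (not ∘ g)
      ≡⟨ count-complement g ⟩
    m ∎

  module _ {g} (g-flips : Shifts π true g) where

    xorSum-flips : ∀ {f} → Shifts π true f → xorSum f ≡ odd (count g)
    xorSum-flips {f} f-flips = begin
      xorSum f      ≡⟨ xorSum≡odd-count f ⟩
      odd (count f) ≡⟨ cong odd (double-injective {count f} {count g} same-double) ⟩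
      odd (count g) ∎
      where
      same-double : count f + count f ≡ count g + count g
      same-double = trans (count-half f-flips) (sym (count-half g-flips))

    xorSum-shifts : ∀ {b f} → Shifts π b f → xorSum f ≡ b ∧ odd (count g)
    xorSum-shifts {true} = xorSum-flips
    xorSum-shifts {false} {f} f-invariant = begin
      xorSum f                              ≡⟨ xorSum-cong (λ c → sym (xor-cancelˡ (g c) (f c))) ⟩
      xorSum (λ c → g c xor (g c xor f c))  ≡⟨ xorSum-xor g (λ c → g c xor f c) ⟩
      xorSum g xor xorSum (λ c → g c xor f c)
        ≡⟨ cong₂ _xor_ (xorSum-flips g-flips) (xorSum-flips g+f-flips) ⟩
      odd (count g) xor odd (count g)       ≡⟨ xor-same (odd (count g)) ⟩
      false                                 ∎
      where
      g+f-flips : Shifts π true (λ c → g c xor f c)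
      g+f-flips c =
        trans (cong₂ _xor_ (g-flips c) (f-invariant c)) (sym (not-distribˡ-xor (g c) (f c)))

data Symbol {n : ℕ} : Fin (suc n) → Set where
  isOne : Symbol one
  isE : (k : Fin n) → Symbol (e k)

symbol : ∀ {n} (c : Fin (suc n)) → Symbol c
symbol {zero} zero = isOne
symbol {suc n} zero = isE zero
symbol {suc n} (suc c) with symbol c
... | isOne = isOne
... | isE k = isE (suc k)

extend : ∀ {n} → Vertex n → Fin (suc n) → Bool
extend {zero} a zero = false
extend {suc n} a zero = a zero
extend {suc n} a (suc c) = extend (a ∘ suc) c

extend-e : ∀ {n} (a : Vertex n) k → extend a (e k) ≡ a k
extend-e {suc n} a zero = refl
extend-e {suc n} a (suc k) = extend-e (a ∘ suc) k

extend-one : ∀ {n} (a : Vertex n) → extend a one ≡ false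
extend-one {zero} a = refl
extend-one {suc n} a = extend-one (a ∘ suc)

xorSum-extend : ∀ {n} (a : Vertex n) → xorSum (extend a) ≡ xorSum a
xorSum-extend {zero} a = refl
xorSum-extend {suc n} a = cong (a zero xor_) (xorSum-extend (a ∘ suc))

column-one≢column-e : ∀ {r n} (v : Fin r → Vertex n) → NonzeroCols v →
  ∀ k → ¬ (∀ t → extend (v t) one ≡ extend (v t) (e k))
column-one≢column-e v nonzero k same with nonzero k
... | t , vₜₖ≡true = not-¬ refl (begin
  false              ≡⟨ extend-one (v t) ⟨
  extend (v t) one   ≡⟨ same t ⟩
  extend (v t) (e k) ≡⟨ extend-e (v t) k ⟩
  v t k              ≡⟨ vₜₖ≡true ⟩
  true               ∎)

extend-columns-injective : ∀ {r n} (v : Fin r → Vertex n) → DistinctCols v → NonzeroCols v →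
  ∀ {c d} → (∀ t → extend (v t) c ≡ extend (v t) d) → c ≡ d
extend-columns-injective v distinct nonzero {c} {d} same with symbol c | symbol d
... | isOne | isOne = refl
... | isOne | isE k = ⊥-elim (column-one≢column-e v nonzero k same)
... | isE k | isOne = ⊥-elim (column-one≢column-e v nonzero k (sym ∘ same))
... | isE k | isE k′ with k ≟ k′
...   | yes k≡k′ = cong e k≡k′
...   | no k≢k′ = ⊥-elim (distinct k k′ k≢k′ λ t →
  trans (sym (extend-e (v t) k)) (trans (same t) (extend-e (v t) k′)))

eqᵇ : ∀ {m} → Fin m → Fin m → Bool
eqᵇ c d = toℕ c ≡ᵇ toℕ d

eqᵇ-complete : ∀ {m} {c d : Fin m} → c ≡ d → eqᵇ c d ≡ true
eqᵇ-complete {c = c} refl = Equivalence.to T-≡ (≡⇒≡ᵇ (toℕ c) (toℕ c) refl)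

eqᵇ-sound : ∀ {m} {c d : Fin m} → eqᵇ c d ≡ true → c ≡ d
eqᵇ-sound {c = c} {d} eq = toℕ-injective (≡ᵇ⇒≡ (toℕ c) (toℕ d) (Equivalence.from T-≡ eq))

Bool-ext : ∀ {x y} → (x ≡ true → y ≡ true) → (y ≡ true → x ≡ true) → x ≡ y
Bool-ext {false} {false} _ _ = refl
Bool-ext {false} {true} _ from = from refl
Bool-ext {true} {false} to _ = sym (to refl)
Bool-ext {true} {true} _ _ = refl

eqᵇ-cong-⇔ : ∀ {m} {c d c′ d′ : Fin m} → (c ≡ d → c′ ≡ d′) → (c′ ≡ d′ → c ≡ d) →
  eqᵇ c d ≡ eqᵇ c′ d′
eqᵇ-cong-⇔ to from = Bool-ext (eqᵇ-complete ∘ to ∘ eqᵇ-sound) (eqᵇ-complete ∘ from ∘ eqᵇ-sound)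

decode-eqᵇ : ∀ {n} (c : Fin (suc n)) (j : Fin n) → decode c j ≡ eqᵇ c one ∨ eqᵇ c (e j)
decode-eqᵇ {n} c j = cong₂ _∨_ (cong (toℕ c ≡ᵇ_) (sym (toℕ-fromℕ n)))
                               (cong (toℕ c ≡ᵇ_) (sym (toℕ-inject₁ j)))

xorSum-select : ∀ {n} (a : Vertex n) c → xorSum (λ s → a s ∧ eqᵇ (e s) c) ≡ extend a c
xorSum-select {zero} a zero = refl
xorSum-select {suc n} a zero =
  trans (cong₂ _xor_ (∧-identityʳ (a zero))
                     (trans (xorSum-cong (∧-zeroʳ ∘ a ∘ suc)) (xorSum-false {n})))
        (xor-identityʳ (a zero))
xorSum-select {suc n} a (suc c) = cong₂ _xor_ (∧-zeroʳ (a zero)) (xorSum-select (a ∘ suc) c)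

module _ {n} (φ : Perm n) {i : Fin n} (φeᵢ≡1 : φ ⟨$⟩ʳ e i ≡ one) where

  φ⁻¹1≡eᵢ : φ ⟨$⟩ˡ one ≡ e i
  φ⁻¹1≡eᵢ = trans (cong (φ ⟨$⟩ˡ_) (sym φeᵢ≡1)) (inverseˡ φ)

  eqᵇ-φ : ∀ c d → eqᵇ (φ ⟨$⟩ʳ c) d ≡ eqᵇ c (φ ⟨$⟩ˡ d)
  eqᵇ-φ c d = eqᵇ-cong-⇔ (λ eq → trans (sym (inverseˡ φ)) (cong (φ ⟨$⟩ˡ_) eq))
                         (λ eq → trans (cong (φ ⟨$⟩ʳ_) eq) (inverseʳ φ))

  decode-φe : ∀ s j → decode (φ ⟨$⟩ʳ e s) j ≡ eqᵇ (e s) (e i) xor eqᵇ (e s) (φ ⟨$⟩ˡ e j)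
  decode-φe s j = begin
    decode (φ ⟨$⟩ʳ e s) j
      ≡⟨ decode-eqᵇ (φ ⟨$⟩ʳ e s) j ⟩
    eqᵇ (φ ⟨$⟩ʳ e s) one ∨ eqᵇ (φ ⟨$⟩ʳ e s) (e j)
      ≡⟨ cong₂ _∨_ (trans (eqᵇ-φ (e s) one) (cong (eqᵇ (e s)) φ⁻¹1≡eᵢ)) (eqᵇ-φ (e s) (e j)) ⟩
    eqᵇ (e s) (e i) ∨ eqᵇ (e s) (φ ⟨$⟩ˡ e j)
      ≡⟨ ∨-disjoint≡xor _ _ disjoint ⟩
    eqᵇ (e s) (e i) xor eqᵇ (e s) (φ ⟨$⟩ˡ e j) ∎
    where
    disjoint : eqᵇ (e s) (e i) ≡ true → eqᵇ (e s) (φ ⟨$⟩ˡ e j) ≡ true → ⊥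
    disjoint s≡i s≡φ⁻¹j = fromℕ≢inject₁ (begin
      one                 ≡⟨ φeᵢ≡1 ⟨
      φ ⟨$⟩ʳ e i          ≡⟨ cong (φ ⟨$⟩ʳ_) (sym (eqᵇ-sound {c = e s} s≡i)) ⟩
      φ ⟨$⟩ʳ e s          ≡⟨ cong (φ ⟨$⟩ʳ_) (eqᵇ-sound {c = e s} s≡φ⁻¹j) ⟩
      φ ⟨$⟩ʳ (φ ⟨$⟩ˡ e j) ≡⟨ inverseʳ φ ⟩
      e j                 ∎)

  act-φ : ∀ a j → act φ a j ≡ a i xor extend a (φ ⟨$⟩ˡ e j)
  act-φ a j = begin
    act φ a j
      ≡⟨ xorSum-cong (λ s → trans (cong (a s ∧_) (decode-φe s j)) (∧-distribˡ-xor (a s) _ _)) ⟩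
    xorSum (λ s → (a s ∧ eqᵇ (e s) (e i)) xor (a s ∧ eqᵇ (e s) (φ ⟨$⟩ˡ e j)))
      ≡⟨ xorSum-xor (λ s → a s ∧ eqᵇ (e s) (e i)) (λ s → a s ∧ eqᵇ (e s) (φ ⟨$⟩ˡ e j)) ⟩
    xorSum (λ s → a s ∧ eqᵇ (e s) (e i)) xor xorSum (λ s → a s ∧ eqᵇ (e s) (φ ⟨$⟩ˡ e j))
      ≡⟨ cong₂ _xor_ (trans (xorSum-select a (e i)) (extend-e a i)) (xorSum-select a _) ⟩
    a i xor extend a (φ ⟨$⟩ˡ e j) ∎

  Fixes⇒Shifts : ∀ {a} → Fixes φ a → Shifts φ (a i) (extend a)
  Fixes⇒Shifts {a} fixes = Shifts-inverse φ {a i} {extend a} shift⁻¹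
    where
    shift⁻¹ : ∀ c → extend a (φ ⟨$⟩ˡ c) ≡ a i xor extend a c
    shift⁻¹ c with symbol c
    ... | isOne = begin
      extend a (φ ⟨$⟩ˡ one) ≡⟨ cong (extend a) φ⁻¹1≡eᵢ ⟩
      extend a (e i)        ≡⟨ extend-e a i ⟩
      a i                   ≡⟨ xor-identityʳ (a i) ⟨
      a i xor false         ≡⟨ cong (a i xor_) (extend-one a) ⟨
      a i xor extend a one  ∎
    ... | isE j = begin
      extend a (φ ⟨$⟩ˡ e j)  ≡⟨ xor-solveˡ {b = a i} (trans (sym (fixes j)) (act-φ a j)) ⟩
      a i xor a j            ≡⟨ cong (a i xor_) (extend-e a j) ⟨
      a i xor extend a (e j) ∎

k+[1+k]%4 : ∀ K → (K + suc K) % 4 ≡ (if odd (suc K) then 1 else 3)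
k+[1+k]%4 zero = refl
k+[1+k]%4 (suc zero) = refl
k+[1+k]%4 (suc (suc K)) = begin
  (suc (suc K) + suc (suc (suc K))) % 4 ≡⟨ cong (_% 4) (shift-by-4 K) ⟩
  (K + suc K + 4) % 4                   ≡⟨ [m+n]%n≡m%n (K + suc K) 4 ⟩
  (K + suc K) % 4                       ≡⟨ k+[1+k]%4 K ⟩
  (if odd (suc K) then 1 else 3)        ≡⟨ cong (λ b → if not b then 1 else 3) (not-involutive (odd K)) ⟨
  (if odd (suc (suc (suc K))) then 1 else 3) ∎
  where
  shift-by-4 : ∀ K → suc (suc K) + suc (suc (suc K)) ≡ K + suc K + 4
  shift-by-4 = solve-∀

%4⇒%2 : ∀ n {k} → n % 4 ≡ k → n % 2 ≡ k % 2
%4⇒%2 n n%4≡k = trans (sym (m∣n⇒o%n%m≡o%m 2 4 n (divides 2 refl))) (cong (_% 2) n%4≡k)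

pred-double-mod4 : ∀ {n N} → suc n ≡ N + N → n % 4 ≡ (if odd N then 1 else 3)
pred-double-mod4 {N = zero} ()
pred-double-mod4 {N = suc K} eq = trans (cong (_% 4) (suc-injective eq)) (k+[1+k]%4 K)

pred-double-residues : ∀ {n N} → suc n ≡ N + N →
  n % 2 ≡ 1 × (n % 4 ≡ 1 → odd N ≡ true) × (n % 4 ≡ 3 → odd N ≡ false)
pred-double-residues {n} {N} eq with odd N | pred-double-mod4 {n} {N} eq
... | true  | n%4≡1 =
  %4⇒%2 n n%4≡1 , (λ _ → refl) , (λ n%4≡3 → contradiction (trans (sym n%4≡1) n%4≡3) λ ())
... | false | n%4≡3 =
  %4⇒%2 n n%4≡3 , (λ n%4≡1 → contradiction (trans (sym n%4≡3) n%4≡1) λ ()) , (λ _ → refl)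

lemma5p4 : (n : ℕ) → 4 ≤ n → (r : ℕ) → (v : Fin r → Vertex n) →
    DistinctRows v → HasZeroRow v → DistinctCols v → NonzeroCols v →
    (φ : Perm n) → (i : Fin n) → φ ⟨$⟩ʳ e i ≡ one →
    (∀ t → Fixes φ (v t)) →
    InvolutionNoFixedE φ × n % 2 ≡ 1 ×
      (n % 4 ≡ 1 → ∀ t → colSum v t ≡ col v i t) ×
      (n % 4 ≡ 3 → ∀ t → colSum v t ≡ false)
lemma5p4 n _ r v _ _ distinct-cols nonzero-cols φ i φeᵢ≡1 fixes =
  let n%2≡1 , odd-N , even-N = pred-double-residues {N = N} (sym (count-half φ flips)) in
  (involutive , no-fixed-e) , n%2≡1 ,
  (λ n%4≡1 t → trans (colSum≡ t) (trans (cong (v t i ∧_) (odd-N n%4≡1)) (∧-identityʳ (v t i)))) ,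
  (λ n%4≡3 t → trans (colSum≡ t) (trans (cong (v t i ∧_) (even-N n%4≡3)) (∧-zeroʳ (v t i))))
  where
  shifts : ∀ t → Shifts φ (v t i) (extend (v t))
  shifts t = Fixes⇒Shifts φ φeᵢ≡1 (fixes t)

  t₀ : Fin r
  t₀ = proj₁ (nonzero-cols i)

  flips : Shifts φ true (extend (v t₀))
  flips = subst (λ b → Shifts φ b (extend (v t₀))) (proj₂ (nonzero-cols i)) (shifts t₀)

  N : ℕ
  N = count (extend (v t₀))

  colSum≡ : ∀ t → colSum v t ≡ v t i ∧ odd N
  colSum≡ t = trans (sym (xorSum-extend (v t))) (xorSum-shifts φ flips (shifts t))

  involutive : ∀ c → φ ⟨$⟩ʳ (φ ⟨$⟩ʳ c) ≡ c
  involutive c = extend-columns-injective v distinct-cols nonzero-cols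
    (λ t → Shifts-involutive φ {v t i} (shifts t) c)

  no-fixed-e : ∀ j → φ ⟨$⟩ʳ e j ≢ e j
  no-fixed-e j = Shifts-true⇒fixpoint-free φ flips (e j)
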